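{- For every $n\ge1$, there exists a derivation in the CoS system $\mathsf{KS}$ with premiss the Statman tautology $\mathsf S_n$ and conclusion $\mathsf S_{n+1}$ whose length is $O(n)$ and whose size is $O(n^3)$.
   Context: CoS: formulae are built from units $\mathsf f,\mathsf t$, atoms $a,\bar a,\dots$, formula variables $A,\bar A,\dots$ by $[\alpha\vee\beta]$ and $(\alpha\wedge\beta)$; $\bar\cdot$ is an involution on atoms and on variables ($\bar a\ne a$); the De Morgan dual $\bar\alpha$ exchanges $\vee/\wedge$, $\mathsf t/\mathsf f$ and negates atoms and variables. Equality $=$ is the smallest context-closed equivalence containing commutativity and associativity of $\vee,\wedge$, $[\alpha\vee\mathsf f]=\alpha$, $(\alpha\wedge\mathsf t)=\alpha$, $[\mathsf t\vee\mathsf t]=\mathsf t$, $(\mathsf f\wedge\mathsf f)=\mathsf f$. A rule $\alpha/\beta$ has instances $\alpha\rho\sigma/\beta\rho\sigma$ for a renaming $\rho$ (atoms to atoms, $\bar a\mapsto$ negation of image) and substitution $\sigma$ (variables to formulae); it generates steps $\xi\{\gamma\}/\xi\{\delta\}$ for any context (formula with one hole) $\xi$. A derivation in $\mathcal S$ with premiss $\alpha_0$ and conclusion $\alpha_k$ is a chain $\alpha_0,\dots,\alpha_k$ alternating $=$-steps and steps generated by rules of $\mathcal S$; its length is $k$ and its size is the total number of occurrences of units, atoms and variables in it. $\mathsf{KS}$ consists of $\mathsf t/[a\vee\bar a]$, $\mathsf f/a$, $[a\vee a]/a$ ($a$ an atom), switch $(A\wedge[B\vee C])/[(A\wedge B)\vee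 C]$ and medial $[(A\wedge B)\vee(C\wedge D)]/([A\vee C]\wedge[B\vee D])$. Statman tautologies: for atoms $c_i,d_i$, $\alpha_i\equiv[\bar c_i\vee\bar d_i]$; for $n\ge k\ge1$, $\beta^n_k\equiv\alpha_n\wedge\dots\wedge\alpha_k$ (with $\beta^k_k=\alpha_k$, $\beta^n_k=(\alpha_n\wedge\beta^{n-1}_k)$); for $n>k\ge1$, $\gamma^n_k\equiv(\beta^n_{k+1}\wedge c_k)$, $\delta^n_k\equiv(\beta^n_{k+1}\wedge d_k)$; and $\mathsf S_n\equiv[\bar\alpha_n\vee[(\gamma^n_{n-1}\wedge\delta^n_{n-1})\vee[\dots\vee[(\gamma^n_1\wedge\delta^n_1)\vee\alpha_1]\dots]]]$, where $\bar\alpha_n=(c_n\wedge d_n)$. -}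

module Defs where

open import Data.Nat using (ℕ; zero; suc; _+_; _*_; _∸_)
open import Data.Bool using (Bool; true; false; not)
open import Data.Product using (Σ; _×_; _,_; ∃)
open import Data.List using (List; []; _∷_; length)
open import Data.Unit using (⊤)
open import Relation.Binary.PropositionalEquality using (_≡_)

-- Atoms and formula variables.
-- An atom (resp. variable) is a name together with a polarity;
-- the involution  ¯  flips the polarity, so  ā ≠ a  and  ā̄ = a.

record Lit : Set where
  constructor lit
  field
    name     : ℕ
    positive : Bool

barL : Lit → Lit
barL (lit k b) = lit k (not b)

data Formula : Set where
  𝕗 𝕥   : Formula
  atom  : Lit → Formula
  var   : Lit → Formula
  _∨_   : Formula → Formula → Formula
  _∧_   : Formula → Formula → Formula

infixr 5 _∨_
infixr 6 _∧_

dual : Formula → Formula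
dual 𝕗 = 𝕥
dual 𝕥 = 𝕗
dual (atom a) = atom (barL a)
dual (var v) = var (barL v)
dual (α ∨ β) = dual α ∧ dual β
dual (α ∧ β) = dual α ∨ dual β

fsize : Formula → ℕ
fsize 𝕗 = 1
fsize 𝕥 = 1
fsize (atom _) = 1
fsize (var _) = 1
fsize (α ∨ β) = fsize α + fsize β
fsize (α ∧ β) = fsize α + fsize β

infix 4 _≈_
data _≈_ : Formula → Formula → Set where
  ≈-refl  : ∀ {α} → α ≈ α
  ≈-sym   : ∀ {α β} → α ≈ β → β ≈ α
  ≈-trans : ∀ {α β γ} → α ≈ β → β ≈ γ → α ≈ γ
  ∨-cong  : ∀ {α α' β β'} → α ≈ α' → β ≈ β' → (α ∨ β) ≈ (α' ∨ β')
  ∧-cong  : ∀ {α α' β β'} → α ≈ α' → β ≈ β' → (α ∧ β) ≈ (α' ∧ β')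
  ∨-comm  : ∀ {α β} → (α ∨ β) ≈ (β ∨ α)
  ∧-comm  : ∀ {α β} → (α ∧ β) ≈ (β ∧ α)
  ∨-assoc : ∀ {α β γ} → ((α ∨ β) ∨ γ) ≈ (α ∨ (β ∨ γ))
  ∧-assoc : ∀ {α β γ} → ((α ∧ β) ∧ γ) ≈ (α ∧ (β ∧ γ))
  ∨-unit  : ∀ {α} → (α ∨ 𝕗) ≈ α
  ∧-unit  : ∀ {α} → (α ∧ 𝕥) ≈ α
  𝕥∨𝕥     : (𝕥 ∨ 𝕥) ≈ 𝕥
  𝕗∧𝕗     : (𝕗 ∧ 𝕗) ≈ 𝕗

-- a renaming is determined by its values on positive atoms;
-- it maps  ā  to the negation of the image of  a
Renaming : Set
Renaming = ℕ → Lit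

renL : Renaming → Lit → Lit
renL ρ (lit k true)  = ρ k
renL ρ (lit k false) = barL (ρ k)

-- a substitution is determined by its values on positive variables;
-- it maps  Ā  to the De Morgan dual of the image of  A
Subst : Set
Subst = ℕ → Formula

substV : Subst → Lit → Formula
substV σ (lit k true)  = σ k
substV σ (lit k false) = dual (σ k)

inst : Renaming → Subst → Formula → Formula
inst ρ σ 𝕗 = 𝕗
inst ρ σ 𝕥 = 𝕥
inst ρ σ (atom a) = atom (renL ρ a)
inst ρ σ (var v) = substV σ v
inst ρ σ (α ∨ β) = inst ρ σ α ∨ inst ρ σ β
inst ρ σ (α ∧ β) = inst ρ σ α ∧ inst ρ σ β

data Context : Set where
  hole : Context
  _∨ₗ_ : Context → Formula → Context
  _∨ᵣ_ : Formula → Context → Context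
  _∧ₗ_ : Context → Formula → Context
  _∧ᵣ_ : Formula → Context → Context

plug : Context → Formula → Formula
plug hole γ = γ
plug (ξ ∨ₗ β) γ = plug ξ γ ∨ β
plug (α ∨ᵣ ξ) γ = α ∨ plug ξ γ
plug (ξ ∧ₗ β) γ = plug ξ γ ∧ β
plug (α ∧ᵣ ξ) γ = α ∧ plug ξ γ

record Rule : Set where
  constructor _/_
  field
    premiss    : Formula
    conclusion : Formula

System : Set₁
System = Rule → Set

data Step (S : System) : Formula → Formula → Set where
  step : ∀ {α β} → S (α / β) → (ρ : Renaming) (σ : Subst) (ξ : Context) →
         Step S (plug ξ (inst ρ σ α)) (plug ξ (inst ρ σ β))

-- Valid S e α rest : the chain  α , rest  alternates, its first step
-- being an =-step if e = true and a rule step if e = false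
Valid : System → Bool → Formula → List Formula → Set
Valid S e α [] = ⊤
Valid S true  α (β ∷ rest) = (α ≈ β) × Valid S false β rest
Valid S false α (β ∷ rest) = Step S α β × Valid S true β rest

lastF : Formula → List Formula → Formula
lastF α [] = α
lastF α (β ∷ rest) = lastF β rest

sizeL : List Formula → ℕ
sizeL [] = 0
sizeL (β ∷ rest) = fsize β + sizeL rest

record Derivation (S : System) : Set where
  constructor deriv
  field
    premiss : Formula
    rest    : List Formula
    firstEq : Bool
    valid   : Valid S firstEq premiss rest

  conclusion : Formula
  conclusion = lastF premiss rest

  len : ℕ
  len = length rest

  size : ℕ
  size = fsize premiss + sizeL rest

-- The system KS (atom name 0 is  a ; variables 0,1,2,3 are A,B,C,D)

a⁺ a⁻ : Formula
a⁺ = atom (lit 0 true)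
a⁻ = atom (lit 0 false)

VA VB VC VD : Formula
VA = var (lit 0 true)
VB = var (lit 1 true)
VC = var (lit 2 true)
VD = var (lit 3 true)

data KS : System where
  ai↓ : KS (𝕥 / (a⁺ ∨ a⁻))
  aw↓ : KS (𝕗 / a⁺)
  ac↓ : KS ((a⁺ ∨ a⁺) / a⁺)
  s↓  : KS ((VA ∧ (VB ∨ VC)) / ((VA ∧ VB) ∨ VC))
  m↓  : KS (((VA ∧ VB) ∨ (VC ∧ VD)) / ((VA ∨ VC) ∧ (VB ∨ VD)))

c d c̄ d̄ : ℕ → Formula
c i = atom (lit (2 * i) true)
d i = atom (lit (suc (2 * i)) true)
c̄ i = atom (lit (2 * i) false)
d̄ i = atom (lit (suc (2 * i)) false)

αS : ℕ → Formula
αS i = c̄ i ∨ d̄ i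

ᾱS : ℕ → Formula
ᾱS i = c i ∧ d i

-- β' k m = β^{k+m}_k
β' : ℕ → ℕ → Formula
β' k zero = αS k
β' k (suc m) = αS (k + suc m) ∧ β' k m

-- β n k = β^n_k   (meaningful for n ≥ k)
β : ℕ → ℕ → Formula
β n k = β' k (n ∸ k)

-- γ^n_k, δ^n_k  (meaningful for n > k)
γ δ : ℕ → ℕ → Formula
γ n k = β n (suc k) ∧ c k
δ n k = β n (suc k) ∧ d k

inner : ℕ → ℕ → Formula
inner n zero = αS 1
inner n (suc k) = (γ n (suc k) ∧ δ n (suc k)) ∨ inner n k

-- S_n  (for n ≥ 1)
Statman : ℕ → Formula
Statman n = ᾱS n ∨ inner n (n ∸ 1)

module Submission where

-- Write α = α_{n+1}, ᾱ = ᾱ_{n+1}.  S_{n+1} arises from S_n by conjoining α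
-- to every disjunct γ^n_k ∧ δ^n_k and to both halves of ᾱ_n, and by
-- prefixing the disjunct ᾱ.  The disjuncts are processed from right to
-- left with 18 rule steps each: P and Q each receive α at the price of a
-- spare ᾱ (identity 𝕥 ⇒ α ∨ ᾱ, then switch), and the spare copies are
-- contracted (medial + atomic contraction) into the ᾱ produced further
-- right.  Every formula met has size O(n²).

open import Defs
open import Data.Nat using (ℕ; suc; _*_; _^_; _≤_)
open import Data.Product using (Σ; ∃; _×_)
open import Relation.Binary.PropositionalEquality using (_≡_)

open import Data.Nat using (zero; _+_; _∸_; _≤?_; z≤n; s≤s)
open import Data.Nat.Properties
open import Data.Nat.Tactic.RingSolver using (solve-∀)
open import Data.Product using (_,_; proj₁; proj₂)
open import Data.List using (List; []; _∷_; length)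
open import Data.List.Relation.Unary.All as All using (All; []; _∷_)
open import Data.Unit using (tt)
open import Data.Bool using (true; false)
open import Relation.Binary.PropositionalEquality
  using (refl; sym; trans; cong; subst₂; module ≡-Reasoning)
open import Relation.Nullary.Decidable using (True; toWitness)
open import Relation.Binary.Bundles using (Setoid)
import Relation.Binary.Reasoning.Setoid

≤-slack : ∀ {x y} k → x + k ≡ y → x ≤ y
≤-slack {x} k eq = m+n≤o⇒m≤o x (≤-reflexive eq)

csize : Context → ℕ
csize hole = 0
csize (ξ ∨ₗ β) = csize ξ + fsize β
csize (α ∨ᵣ ξ) = fsize α + csize ξ
csize (ξ ∧ₗ β) = csize ξ + fsize β
csize (α ∧ᵣ ξ) = fsize α + csize ξ

extendRight : ∀ {x} c y z → x ≡ c + y → x + z ≡ (c + z) + y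
extendRight c y z refl = +-comm-assoc c y z
  where +-comm-assoc : ∀ x y z → (x + y) + z ≡ (x + z) + y
        +-comm-assoc = solve-∀

extendLeft : ∀ {x} w c y → x ≡ c + y → w + x ≡ (w + c) + y
extendLeft w c y refl = sym (+-assoc w c y)

fsize-plug : ∀ ξ φ → fsize (plug ξ φ) ≡ csize ξ + fsize φ
fsize-plug hole φ = refl
fsize-plug (ξ ∨ₗ β) φ = extendRight (csize ξ) (fsize φ) (fsize β) (fsize-plug ξ φ)
fsize-plug (α ∨ᵣ ξ) φ = extendLeft (fsize α) (csize ξ) (fsize φ) (fsize-plug ξ φ)
fsize-plug (ξ ∧ₗ β) φ = extendRight (csize ξ) (fsize φ) (fsize β) (fsize-plug ξ φ)
fsize-plug (α ∧ᵣ ξ) φ = extendLeft (fsize α) (csize ξ) (fsize φ) (fsize-plug ξ φ)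

fsize-plug≤ : ∀ ξ {φ B} → fsize φ ≤ B → fsize (plug ξ φ) ≤ csize ξ + B
fsize-plug≤ ξ {φ} h = ≤-trans (≤-reflexive (fsize-plug ξ φ)) (+-monoʳ-≤ (csize ξ) h)

_∘ᶜ_ : Context → Context → Context
hole ∘ᶜ ξ' = ξ'
(ξ ∨ₗ β) ∘ᶜ ξ' = (ξ ∘ᶜ ξ') ∨ₗ β
(α ∨ᵣ ξ) ∘ᶜ ξ' = α ∨ᵣ (ξ ∘ᶜ ξ')
(ξ ∧ₗ β) ∘ᶜ ξ' = (ξ ∘ᶜ ξ') ∧ₗ β
(α ∧ᵣ ξ) ∘ᶜ ξ' = α ∧ᵣ (ξ ∘ᶜ ξ')

plug-∘ᶜ : ∀ ξ ξ' φ → plug (ξ ∘ᶜ ξ') φ ≡ plug ξ (plug ξ' φ)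
plug-∘ᶜ hole ξ' φ = refl
plug-∘ᶜ (ξ ∨ₗ β) ξ' φ = cong (_∨ β) (plug-∘ᶜ ξ ξ' φ)
plug-∘ᶜ (α ∨ᵣ ξ) ξ' φ = cong (α ∨_) (plug-∘ᶜ ξ ξ' φ)
plug-∘ᶜ (ξ ∧ₗ β) ξ' φ = cong (_∧ β) (plug-∘ᶜ ξ ξ' φ)
plug-∘ᶜ (α ∧ᵣ ξ) ξ' φ = cong (α ∧_) (plug-∘ᶜ ξ ξ' φ)

≈-plug : ∀ ξ {φ ψ} → φ ≈ ψ → plug ξ φ ≈ plug ξ ψ
≈-plug hole e = e
≈-plug (ξ ∨ₗ β) e = ∨-cong (≈-plug ξ e) ≈-refl
≈-plug (α ∨ᵣ ξ) e = ∨-cong ≈-refl (≈-plug ξ e)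
≈-plug (ξ ∧ₗ β) e = ∧-cong (≈-plug ξ e) ≈-refl
≈-plug (α ∧ᵣ ξ) e = ∧-cong ≈-refl (≈-plug ξ e)

step-plug : ∀ {S} ξ {φ ψ} → Step S φ ψ → Step S (plug ξ φ) (plug ξ ψ)
step-plug ξ (step r ρ σ ξ') =
  subst₂ (Step _) (plug-∘ᶜ ξ ξ' _) (plug-∘ᶜ ξ ξ' _) (step r ρ σ (ξ ∘ᶜ ξ'))

≈-setoid : Setoid _ _
≈-setoid = record
  { Carrier = Formula
  ; _≈_ = _≈_
  ; isEquivalence = record { refl = ≈-refl ; sym = ≈-sym ; trans = ≈-trans }
  }

module ≈-Reasoning = Relation.Binary.Reasoning.Setoid ≈-setoid

sizeL≤ : ∀ {B} (l : List Formula) → All (λ φ → fsize φ ≤ B) l → sizeL l ≤ length l * B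
sizeL≤ [] [] = z≤n
sizeL≤ (φ ∷ l) (h ∷ hs) = +-mono-≤ h (sizeL≤ l hs)

-- Chains  = , rule , = , … , rule , =  from α to β with r rule steps.
-- Each is a derivation that starts and ends with an =-step.

data Chain (S : System) : ℕ → Formula → Formula → Set where
  done : ∀ {α β} → α ≈ β → Chain S 0 α β
  more : ∀ {r α β γ δ} → α ≈ β → Step S β γ → Chain S r γ δ → Chain S (suc r) α δ

module _ {S : System} where

  formulas : ∀ {r α β} → Chain S r α β → List Formula
  formulas (done {β = β} _) = β ∷ []
  formulas (more {β = β} {γ = γ} _ _ c) = β ∷ γ ∷ formulas c

  valid : ∀ {r α β} (c : Chain S r α β) → Valid S true α (formulas c)
  valid (done e) = e , tt
  valid (more e s c) = e , s , valid c

  toDerivation : ∀ {r α β} → Chain S r α β → Derivation S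
  toDerivation {α = α} c = deriv α (formulas c) true (valid c)

  conclusion-toDerivation : ∀ {r α β} (c : Chain S r α β) →
                            Derivation.conclusion (toDerivation c) ≡ β
  conclusion-toDerivation (done e) = refl
  conclusion-toDerivation (more e s c) = conclusion-toDerivation c

  len-toDerivation : ∀ {r α β} (c : Chain S r α β) →
                     Derivation.len (toDerivation c) ≡ suc (r + r)
  len-toDerivation (done e) = refl
  len-toDerivation (more {r = r} e s c) =
    cong (λ l → suc (suc l)) (trans (len-toDerivation c) (sym (+-suc r r)))

  Within : ℕ → ∀ {r α β} → Chain S r α β → Set
  Within B c = All (λ φ → fsize φ ≤ B) (formulas c)

  size-toDerivation : ∀ {B r α β} (c : Chain S r α β) → fsize α ≤ B → Within B c →
                      Derivation.size (toDerivation c) ≤ suc (Derivation.len (toDerivation c)) * B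
  size-toDerivation c hα hc = +-mono-≤ hα (sizeL≤ (formulas c) hc)

BChain : System → ℕ → ℕ → Formula → Formula → Set
BChain S r B α β = Σ (Chain S r α β) (Within B)

module _ {S : System} where

  infixr 4 _◂_
  infixr 3 _⊕_

  -- a closed chain, whose size bound can be checked by evaluation
  byComputation : ∀ {r α β} B (c : Chain S r α β) →
                  {_ : True (All.all? (λ φ → fsize φ ≤? B) (formulas c))} → BChain S r B α β
  byComputation B c {ok} = c , toWitness ok

  rule : ∀ {B α β} → Step S α β → fsize α ≤ B → fsize β ≤ B → BChain S 1 B α β
  rule s hα hβ = more ≈-refl s (done ≈-refl) , hα ∷ hβ ∷ hβ ∷ []

  weaken : ∀ {B B' r α β} → B ≤ B' → BChain S r B α β → BChain S r B' α β
  weaken le (c , h) = c , All.map (λ hφ → ≤-trans hφ le) h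

  _◂_ : ∀ {r B α β γ} → α ≈ β → BChain S r B β γ → BChain S r B α γ
  e ◂ (done e' , h) = done (≈-trans e e') , h
  e ◂ (more e' s c , h) = more (≈-trans e e') s c , h

  close : ∀ {r B α β γ} → BChain S r B α β → β ≈ γ → fsize γ ≤ B → BChain S r B α γ
  close (done e , _) e' hγ = done (≈-trans e e') , hγ ∷ []
  close (more e s c , hβ ∷ hγ ∷ h) e' hδ with close (c , h) e' hδ
  ... | c' , h' = more e s c' , hβ ∷ hγ ∷ h'

  _⊕_ : ∀ {r r' B α β γ} → BChain S r B α β → BChain S r' B β γ → BChain S (r + r') B α γ
  (done e , _) ⊕ d = e ◂ d
  (more e s c , hβ ∷ hγ ∷ h) ⊕ d with (c , h) ⊕ d
  ... | c' , h' = more e s c' , hβ ∷ hγ ∷ h'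

  lift : ∀ {r B α β} ξ → BChain S r B α β → BChain S r (csize ξ + B) (plug ξ α) (plug ξ β)
  lift ξ (done e , hβ ∷ []) = done (≈-plug ξ e) , fsize-plug≤ ξ hβ ∷ []
  lift ξ (more e s c , hβ ∷ hγ ∷ h) with lift ξ (c , h)
  ... | c' , h' = more (≈-plug ξ e) (step-plug ξ s) c' , fsize-plug≤ ξ hβ ∷ fsize-plug≤ ξ hγ ∷ h'

args : Formula → Formula → Formula → Formula → Subst
args A B C D 0 = A
args A B C D 1 = B
args A B C D 2 = C
args A B C D _ = D

atomTo : ℕ → Renaming
atomTo k _ = lit k true

switch : ∀ {A B C} ξ → Step KS (plug ξ (A ∧ (B ∨ C))) (plug ξ ((A ∧ B) ∨ C))
switch {A} {B} {C} ξ = step s↓ (atomTo 0) (args A B C 𝕥) ξ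

medial : ∀ {A B C D} ξ → Step KS (plug ξ ((A ∧ B) ∨ (C ∧ D))) (plug ξ ((A ∨ C) ∧ (B ∨ D)))
medial {A} {B} {C} {D} ξ = step m↓ (atomTo 0) (args A B C D) ξ

identity : ∀ k ξ → Step KS (plug ξ 𝕥) (plug ξ (atom (lit k true) ∨ atom (lit k false)))
identity k ξ = step ai↓ (atomTo k) (args 𝕥 𝕥 𝕥 𝕥) ξ

weakening : ∀ k ξ → Step KS (plug ξ 𝕗) (plug ξ (atom (lit k true)))
weakening k ξ = step aw↓ (atomTo k) (args 𝕥 𝕥 𝕥 𝕥) ξ

contraction : ∀ k ξ → Step KS (plug ξ (atom (lit k true) ∨ atom (lit k true))) (plug ξ (atom (lit k true)))
contraction k ξ = step ac↓ (atomTo k) (args 𝕥 𝕥 𝕥 𝕥) ξ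

-- bring three copies of e to the front: used to contract them pairwise
regroup : ∀ {x e i} → ((x ∨ e) ∨ e) ∨ (e ∨ i) ≈ ((e ∨ e) ∨ e) ∨ (x ∨ i)
regroup {x} {e} {i} = begin
  ((x ∨ e) ∨ e) ∨ (e ∨ i)   ≈⟨ ∨-cong (≈-trans ∨-assoc ∨-comm) ≈-refl ⟩
  ((e ∨ e) ∨ x) ∨ (e ∨ i)   ≈⟨ ∨-assoc ⟩
  (e ∨ e) ∨ (x ∨ (e ∨ i))   ≈⟨ ∨-cong ≈-refl (≈-trans (≈-sym ∨-assoc) (∨-cong ∨-comm ≈-refl)) ⟩
  (e ∨ e) ∨ ((e ∨ x) ∨ i)   ≈⟨ ∨-cong ≈-refl ∨-assoc ⟩
  (e ∨ e) ∨ (e ∨ (x ∨ i))   ≈⟨ ≈-sym ∨-assoc ⟩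
  ((e ∨ e) ∨ e) ∨ (x ∨ i)   ∎
  where open ≈-Reasoning

module Pair (k : ℕ) where

  a ā : Formula
  a = αS k
  ā = ᾱS k

  -- 𝕥 ⇒ [α ∨ ᾱ]: identity on c_k and d_k, then two switches
  excludedMiddle : BChain KS 4 4 𝕥 (a ∨ ā)
  excludedMiddle = byComputation 4
    (more (≈-sym ∧-unit) (identity (2 * k) (hole ∧ₗ 𝕥))
    (more ≈-refl (identity (suc (2 * k)) ((c k ∨ c̄ k) ∧ᵣ hole))
    (more ∧-comm (switch hole)
    (more (∨-cong ∧-comm ≈-refl) (switch (hole ∨ₗ c̄ k))
    (done (≈-trans ∨-assoc (≈-trans ∨-comm (∨-cong ∨-comm ≈-refl))))))))

  -- [ᾱ ∨ ᾱ] ⇒ ᾱ: medial, then atomic contraction on c_k and d_k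
  contract : BChain KS 3 4 (ā ∨ ā) ā
  contract = byComputation 4
    (more ≈-refl (medial hole)
    (more ≈-refl (contraction (2 * k) (hole ∧ₗ (d k ∨ d k)))
    (more ≈-refl (contraction (suc (2 * k)) (c k ∧ᵣ hole)) (done ≈-refl))))

  weakenPair : BChain KS 2 2 𝕗 ā
  weakenPair = byComputation 2
    (more (≈-sym 𝕗∧𝕗) (weakening (2 * k) (hole ∧ₗ 𝕗))
    (more ≈-refl (weakening (suc (2 * k)) (c k ∧ᵣ hole)) (done ≈-refl)))

  prefix : ∀ F → BChain KS 2 (fsize F + 2) F (ā ∨ F)
  prefix F = ≈-sym ∨-unit ◂
    close (weaken (≤-reflexive (cong (_+ 2) (+-identityʳ (fsize F)))) (lift (F ∨ᵣ hole) weakenPair))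
          ∨-comm (≤-reflexive (+-comm 2 (fsize F)))

  -- P ⇒ [(P ∧ α) ∨ ᾱ]: attach α to P at the price of a spare ᾱ
  attach : ∀ P → BChain KS 5 (fsize P + 4) P ((P ∧ a) ∨ ā)
  attach P = ≈-sym ∧-unit ◂
    weaken (≤-reflexive (cong (_+ 4) (+-identityʳ (fsize P)))) (lift (P ∧ᵣ hole) excludedMiddle)
    ⊕ rule (switch hole) ≤-refl (≤-reflexive (+-assoc (fsize P) 2 2))

  -- (P ∧ Q) ⇒ [[((Q ∧ α) ∧ (P ∧ α)) ∨ ᾱ] ∨ ᾱ]: attach α to P and to Q,
  -- then switch both spare copies of ᾱ out of the conjunction.  All
  -- formulas have size p + q + 8, up to the order of the summands.
  expandConj : ∀ P Q → BChain KS 12 (fsize P + fsize Q + 8) (P ∧ Q) ((((Q ∧ a) ∧ (P ∧ a)) ∨ ā) ∨ ā)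
  expandConj P Q =
    weaken (≤-slack 4 (attachedLeft p q)) (lift (hole ∧ₗ Q) (attach P))
    ⊕ weaken (≤-reflexive (attachedRight p q)) (lift (((P ∧ a) ∨ ā) ∧ᵣ hole) (attach Q))
    ⊕ rule (switch hole) (≤-reflexive (bothAttached p q)) (≤-reflexive (firstSwitched p q))
    ⊕ ∨-cong ∧-comm ≈-refl ◂
      rule (switch (hole ∨ₗ ā)) (≤-reflexive (commuted p q)) (≤-reflexive (secondSwitched p q))
    where
      p q : ℕ
      p = fsize P
      q = fsize Q
      attachedLeft : ∀ p q → q + (p + 4) + 4 ≡ p + q + 8
      attachedLeft = solve-∀
      attachedRight : ∀ p q → (((p + 2) + 2) + 0) + (q + 4) ≡ p + q + 8
      attachedRight = solve-∀
      bothAttached : ∀ p q → ((p + 2) + 2) + ((q + 2) + 2) ≡ p + q + 8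
      bothAttached = solve-∀
      firstSwitched : ∀ p q → (((p + 2) + 2) + (q + 2)) + 2 ≡ p + q + 8
      firstSwitched = solve-∀
      commuted : ∀ p q → ((q + 2) + ((p + 2) + 2)) + 2 ≡ p + q + 8
      commuted = solve-∀
      secondSwitched : ∀ p q → (((q + 2) + (p + 2)) + 2) + 2 ≡ p + q + 8
      secondSwitched = solve-∀

  -- The treatment of one disjunct P ∧ Q in front of a chain I ⇒ [ᾱ ∨ I']
  -- for the disjuncts to its right: P ∧ Q becomes (Q ∧ α) ∧ (P ∧ α) ≈ Y and
  -- its two spare copies of ᾱ are contracted into the one already present.
  -- Formulas exceed the bound B of the given chain by at most W.
  absorb : ∀ {r B I I'} P Q Y W → ((Q ∧ a) ∧ (P ∧ a)) ≈ Y →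
           fsize P + fsize Q + 10 ≤ W → fsize Y + 2 ≤ W → fsize I' ≤ B →
           BChain KS r B I (ā ∨ I') → BChain KS (r + 18) (W + B) ((P ∧ Q) ∨ I) (ā ∨ (Y ∨ I'))
  absorb {B = B} {I' = I'} P Q Y W eqY hPQ hY hI rest =
      weaken (+-monoˡ-≤ B (≤-trans (≤-slack 10 (cong (_+ 10) (+-identityʳ (p + q)))) hPQ))
             (lift ((P ∧ Q) ∨ᵣ hole) rest)
    ⊕ weaken (viaPQ (≤-reflexive (expanded p q i))) (lift (hole ∨ₗ (ā ∨ I')) (expandConj P Q))
    ⊕ regroup ◂
      weaken (viaPQ (≤-reflexive (firstContracted p q i))) (lift ((hole ∨ₗ ā) ∨ₗ (Z ∨ I')) contract)
    ⊕ close (weaken (viaPQ (≤-slack 2 (secondContracted p q i))) (lift (hole ∨ₗ (Z ∨ I')) contract))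
            (∨-cong ≈-refl (∨-cong eqY ≈-refl))
            (≤-trans (≤-reflexive (finished (fsize Y) i)) (+-mono-≤ hY hI))
    where
      p q i : ℕ
      p = fsize P
      q = fsize Q
      i = fsize I'
      Z : Formula
      Z = (Q ∧ a) ∧ (P ∧ a)
      viaPQ : ∀ {x} → x ≤ (p + q + 10) + i → x ≤ W + B
      viaPQ h = ≤-trans h (+-mono-≤ hPQ hI)
      expanded : ∀ p q i → (2 + i) + (p + q + 8) ≡ (p + q + 10) + i
      expanded = solve-∀
      firstContracted : ∀ p q i → (2 + (((q + 2) + (p + 2)) + i)) + 4 ≡ (p + q + 10) + i
      firstContracted = solve-∀
      secondContracted : ∀ p q i → ((((q + 2) + (p + 2)) + i) + 4) + 2 ≡ (p + q + 10) + i
      secondContracted = solve-∀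
      finished : ∀ y i → 2 + (y + i) ≡ (y + 2) + i
      finished = solve-∀

-- β^{k+m}_k is a conjunction of m + 1 disjunctions of two atoms
β'-size : ∀ k m → fsize (β' k m) ≡ 2 + 2 * m
β'-size k zero = refl
β'-size k (suc m) = cong (2 +_) (trans (β'-size k m) (sym (*-suc 2 m)))

β-size≤ : ∀ M j → fsize (β M j) ≤ 2 + 2 * M
β-size≤ M j = ≤-trans (≤-reflexive (β'-size j (M ∸ j))) (+-monoʳ-≤ 2 (*-monoʳ-≤ 2 (m∸n≤m M j)))

disjunct-size≤ : ∀ M j → fsize (γ M j ∧ δ M j) ≤ 4 * M + 6
disjunct-size≤ M j =
  ≤-trans (+-mono-≤ (+-monoˡ-≤ 1 (β-size≤ M (suc j))) (+-monoˡ-≤ 1 (β-size≤ M (suc j))))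
          (≤-reflexive (twoHalves M))
  where twoHalves : ∀ M → (2 + 2 * M + 1) + (2 + 2 * M + 1) ≡ 4 * M + 6
        twoHalves = solve-∀

inner-size≤ : ∀ M k {V} → 4 * M + 6 ≤ V → fsize (inner M k) ≤ k * V + 2
inner-size≤ M zero h = ≤-refl
inner-size≤ M (suc k) {V} h =
  ≤-trans (+-mono-≤ (≤-trans (disjunct-size≤ M (suc k)) h) (inner-size≤ M k h))
          (≤-reflexive (sym (+-assoc V (k * V) 2)))

β-step : ∀ {n j} → suc j ≤ n → β (suc n) (suc j) ≡ αS (suc n) ∧ β n (suc j)
β-step {n} {j} h = begin
  β' (suc j) (suc n ∸ suc j)           ≡⟨ cong (β' (suc j)) (+-∸-assoc 1 h) ⟩
  αS (suc j + suc l) ∧ β' (suc j) l    ≡⟨ cong (λ i → αS i ∧ β n (suc j)) (trans (+-suc (suc j) l) (cong suc (m+[n∸m]≡n h))) ⟩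
  αS (suc n) ∧ β n (suc j)             ∎
  where
    open ≡-Reasoning
    l : ℕ
    l = n ∸ suc j

swapAttached : ∀ {A P Q} → (Q ∧ A) ∧ (P ∧ A) ≈ (A ∧ P) ∧ (A ∧ Q)
swapAttached = ≈-trans ∧-comm (∧-cong ∧-comm ∧-comm)

-- what absorb makes of the disjunct γ^n_j ∧ δ^n_j is γ^{n+1}_j ∧ δ^{n+1}_j …
attached-disjunct : ∀ {n j} → suc j ≤ n →
                    (δ n j ∧ αS (suc n)) ∧ (γ n j ∧ αS (suc n)) ≈ γ (suc n) j ∧ δ (suc n) j
attached-disjunct h rewrite β-step h = ≈-trans swapAttached (∧-cong (≈-sym ∧-assoc) (≈-sym ∧-assoc))

-- … and of the leading disjunct ᾱ_n = c_n ∧ d_n it makes γ^{n+1}_n ∧ δ^{n+1}_n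
attached-top : ∀ n → (d n ∧ αS (suc n)) ∧ (c n ∧ αS (suc n)) ≈ γ (suc n) n ∧ δ (suc n) n
attached-top n rewrite n∸n≡0 n = swapAttached

module Extension (m : ℕ) where

  n N : ℕ
  n = suc m
  N = suc n

  open Pair N

  -- bound on the material added by absorbing one disjunct
  W : ℕ
  W = 4 * N + 12

  -- a disjunct of S_n, processed by absorb, fits into W
  old-disjunct-room : 4 * n + 6 + 10 ≡ W
  old-disjunct-room = room m
    where room : ∀ m → 4 * suc m + 6 + 10 ≡ 4 * suc (suc m) + 12
          room = solve-∀

  new-disjunct-fits : ∀ j → fsize (γ N j ∧ δ N j) + 2 ≤ W
  new-disjunct-fits j = ≤-trans (+-monoˡ-≤ 2 (disjunct-size≤ N j))
                          (≤-trans (≤-reflexive (+-assoc (4 * N) 6 2)) (+-monoʳ-≤ (4 * N) (m≤m+n 8 4)))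

  new-inner-fits : ∀ k → fsize (inner N k) ≤ k * W + 4
  new-inner-fits k = ≤-trans (inner-size≤ N k (+-monoʳ-≤ (4 * N) (m≤m+n 6 6))) (+-monoʳ-≤ (k * W) (m≤m+n 2 2))

  -- number of rule steps spent on the last k + 1 disjuncts
  cost : ℕ → ℕ
  cost zero = 2
  cost (suc k) = cost k + 18

  shift : ∀ k → k ≤ m → BChain KS (cost k) (k * W + 4) (inner n k) (ā ∨ inner N k)
  shift zero _ = prefix (αS 1)
  shift (suc k) h = weaken (≤-reflexive (sym (+-assoc W (k * W) 4)))
    (absorb (γ n (suc k)) (δ n (suc k)) (γ N (suc k) ∧ δ N (suc k)) W (attached-disjunct (s≤s h))
            (≤-trans (+-monoˡ-≤ 10 (disjunct-size≤ n (suc k))) (≤-reflexive old-disjunct-room))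
            (new-disjunct-fits (suc k)) (new-inner-fits k) (shift k (≤-trans (n≤1+n k) h)))

  extension : BChain KS (cost n) (n * W + 4) (Statman n) (Statman N)
  extension = weaken (≤-reflexive (sym (+-assoc W (m * W) 4)))
    (absorb (c n) (d n) (γ N n ∧ δ N n) W (attached-top n) (m≤n+m 12 (4 * N))
            (new-disjunct-fits n) (new-inner-fits m) (shift m ≤-refl))

  premiss-fits : fsize (Statman n) ≤ n * W + 4
  premiss-fits = ≤-trans (+-monoʳ-≤ 2 (inner-size≤ n m (≤-slack 10 old-disjunct-room)))
                         (≤-slack W (rearrange (m * W) W))
    where rearrange : ∀ x w → 2 + (x + 2) + w ≡ w + x + 4
          rearrange = solve-∀

  cost-closed : ∀ k → cost k ≡ 18 * k + 2
  cost-closed zero = refl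
  cost-closed (suc k) = trans (cong (_+ 18) (cost-closed k)) (next k)
    where next : ∀ k → 18 * k + 2 + 18 ≡ 18 * suc k + 2
          next = solve-∀

  derivation : Derivation KS
  derivation = toDerivation (proj₁ extension)

  -- length + 1 = 36 n + 6 ≤ 42 n
  length-linear : suc (Derivation.len derivation) + 6 * m ≡ 42 * n
  length-linear = begin
    suc (Derivation.len derivation) + 6 * m          ≡⟨ cong (λ l → suc l + 6 * m) (len-toDerivation (proj₁ extension)) ⟩
    suc (suc (cost n + cost n)) + 6 * m              ≡⟨ cong (λ r → suc (suc (r + r)) + 6 * m) (cost-closed n) ⟩
    suc (suc ((18 * n + 2) + (18 * n + 2))) + 6 * m  ≡⟨ linear m ⟩
    42 * n                                           ∎
    where
      open ≡-Reasoning
      linear : ∀ m → suc (suc ((18 * suc m + 2) + (18 * suc m + 2))) + 6 * m ≡ 42 * suc m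
      linear = solve-∀

  length-bound : suc (Derivation.len derivation) ≤ 42 * n
  length-bound = ≤-slack (6 * m) length-linear

  -- every formula has size ≤ n W + 4 = 4 n² + 16 n + 4 ≤ 24 n²
  width-quadratic : n * W + 4 ≤ 24 * (n * n)
  width-quadratic = ≤-slack (20 * (m * m) + 24 * m) (quadratic m)
    where quadratic : ∀ m → suc m * (4 * suc (suc m) + 12) + 4 + (20 * (m * m) + 24 * m) ≡ 24 * (suc m * suc m)
          quadratic = solve-∀

  size-cubic : Derivation.size derivation ≤ 1008 * n ^ 3
  size-cubic = begin
    Derivation.size derivation                     ≤⟨ size-toDerivation (proj₁ extension) premiss-fits (proj₂ extension) ⟩
    suc (Derivation.len derivation) * (n * W + 4)  ≤⟨ *-mono-≤ length-bound width-quadratic ⟩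
    (42 * n) * (24 * (n * n))                      ≡⟨ cubic m ⟩
    1008 * n ^ 3                                   ∎
    where
      open ≤-Reasoning
      cubic : ∀ m → (42 * suc m) * (24 * (suc m * suc m)) ≡ 1008 * (suc m * (suc m * (suc m * 1)))
      cubic = solve-∀

lemma3p11 : Σ ℕ λ C₁ → Σ ℕ λ C₂ → (n : ℕ) → 1 ≤ n →
    Σ (Derivation KS) λ D →
      (Derivation.premiss D ≡ Statman n) ×
      (Derivation.conclusion D ≡ Statman (suc n)) ×
      (Derivation.len D ≤ C₁ * n) ×
      (Derivation.size D ≤ C₂ * (n ^ 3))
lemma3p11 = 42 , 1008 , λ where
  (suc m) _ → let open Extension m in
    derivation , refl , conclusion-toDerivation (proj₁ extension) ,
    ≤-trans (n≤1+n _) length-bound , size-cubic
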